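{- Let $r\ge 2$ be an integer and define $h_r:\{2,3,\dots\}\to\mathbb{R}$ by \[ h_r(k)=\begin{cases}\dfrac{(-1)^{r-k}(k-2)!}{(r-2)!\,(r+1/r-1)}+\displaystyle\sum_{i=1}^{r-k}\frac{(-1)^{i+1}(k-2)!}{(k-2+i)!} & \text{if } 2\le k\le r,\\[2mm] 0 & \text{if } k>r.\end{cases} \] Then for all integers $k\ge 2$: (A1) $h_r(k+1)\le h_r(k)$; (A2) $0\le h_r(k)\le 1/(k-1+1/k)$; (A3) $h_r(k+1)\le 1-(k-1)h_r(k)$. -}

module Defs where

open import Data.Nat as ℕ using (ℕ; zero; suc; _∸_; _!; _≤?_)
open import Data.Nat.Properties using (_!≢0)
open import Data.Integer as ℤ using (ℤ; +_; -[1+_])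
open import Data.Rational as ℚ using (ℚ; 0ℚ; _/_; _+_; _*_)
open import Data.List using (List; map; foldr; applyUpTo)
open import Relation.Nullary using (yes; no)

neg1^ : ℕ → ℚ
neg1^ n = (-[1+ 0 ] ℤ.^ n) / 1

fact/ : ℕ → ℕ → ℚ
fact/ a b = (+ (a !)) / (b !)
  where instance _ = b !≢0

-- 1 / (r + 1/r - 1) = r / (r² - r + 1)   (valid for r ≥ 1; written with
-- the positive natural denominator suc (r*r ∸ r) = r² - r + 1)
inv-r+1/r-1 : ℕ → ℚ
inv-r+1/r-1 r = (+ r) / suc (r ℕ.* r ∸ r)

sum1to : ℕ → (ℕ → ℚ) → ℚ
sum1to n f = foldr _+_ 0ℚ (map f (applyUpTo suc n))

h : ℕ → ℕ → ℚ
h r k with k ≤? r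
... | yes _ = neg1^ (r ∸ k) * fact/ (k ∸ 2) (r ∸ 2) * inv-r+1/r-1 r
            + sum1to (r ∸ k) (λ i → neg1^ (suc i) * fact/ (k ∸ 2) (k ∸ 2 ℕ.+ i))
... | no _  = 0ℚ

-- For 2 ≤ k < r the alternating factorial sums defining h telescope into the
-- recurrence (k - 1) h(k) + h(k + 1) = 1, while h(r) = 1/(r + 1/r - 1) and h vanishes
-- beyond r. Descending from k = r, the recurrence carries the bounds
-- 1/((k - 1)(k - 2) + 1) ≤ h(k) ≤ 1/(k - 1 + 1/k), valid for k ≥ 3, from h(k + 1) to h(k).
-- They give A2; A3 holds with equality below r, and A1 follows from
-- k h(k + 1) ≤ k/(k + 1/(k + 1)) ≤ 1 = (k - 1) h(k) + h(k + 1).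

module Submission where

open import Defs
open import Data.Nat as ℕ using (ℕ; zero; suc; _∸_; _!; _≤?_; z≤n; s≤s)
open import Data.Nat.Properties as ℕP using (_!≢0)
open import Data.Nat.Tactic.RingSolver using (solve)
open import Data.Integer as ℤ using (+_; -[1+_])
import Data.Integer.Properties as ℤP
open import Data.Rational using (ℚ; 0ℚ; 1ℚ; _≤_; _/_; _+_; _-_; _*_; -_; toℚᵘ; Positive; NonNegative)
import Data.Rational.Properties as ℚP
open import Data.Rational.Unnormalised as ℚᵘ using (mkℚᵘ; *≤*) renaming (_≃_ to _≃ᵘ_)
import Data.Rational.Unnormalised.Properties as ℚᵘP
open import Data.List using ([]; _∷_; foldr)
open import Data.List.Properties using (map-applyUpTo)
open import Data.Product using (_×_; _,_; proj₁; proj₂)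
open import Data.Empty using (⊥-elim)
open import Function.Base using (_∘_)
open import Relation.Nullary using (yes; no)
open import Relation.Binary.Definitions using (tri<; tri≈; tri>)
open import Relation.Binary.PropositionalEquality
open import Relation.Nullary.Decidable.Core using (dec⇒maybe)
open import Tactic.RingSolver using (solve-∀)
open import Algebra.Properties.Group ℚP.+-0-group using (⁻¹-involutive)
import Tactic.RingSolver.Core.AlmostCommutativeRing as ACR

ℚ-ring : ACR.AlmostCommutativeRing _ _
ℚ-ring = ACR.fromCommutativeRing ℚP.+-*-commutativeRing (λ x → dec⇒maybe (0ℚ ℚP.≟ x))

≤-by-difference : ∀ {m n} d → n ≡ m ℕ.+ d → m ℕ.≤ n
≤-by-difference {m} d refl = ℕP.m≤m+n m d

+-cancelʳ-≤ : ∀ r {p q} → p + r ≤ q + r → p ≤ q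
+-cancelʳ-≤ r {p} {q} le = subst₂ _≤_ (add-sub p r) (add-sub q r) (ℚP.+-monoˡ-≤ (- r) le)
  where
  add-sub : ∀ p r → p + r - r ≡ p
  add-sub = solve-∀ ℚ-ring

p≤q⇒0≤q-p : ∀ {p q} → p ≤ q → 0ℚ ≤ q - p
p≤q⇒0≤q-p {p} {q} p≤q = subst (_≤ q - p) (ℚP.+-inverseʳ p) (ℚP.+-monoˡ-≤ (- p) p≤q)

p+q≡r⇒q≡r-p : ∀ p {q r} → p + q ≡ r → q ≡ r - p
p+q≡r⇒q≡r-p p {q} refl = cancel p q
  where
  cancel : ∀ p q → q ≡ p + q - p
  cancel = solve-∀ ℚ-ring

≤-root : ∀ t {y x a} .{{_ : Positive t}} → t * y + x ≡ 1ℚ → t * a + x ≤ 1ℚ → a ≤ y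
≤-root t {y} {x} {a} root le = ℚP.*-cancelˡ-≤-pos t (+-cancelʳ-≤ x (subst (t * a + x ≤_) (sym root) le))

root-≤ : ∀ t {y x b} .{{_ : Positive t}} → t * y + x ≡ 1ℚ → 1ℚ ≤ t * b + x → y ≤ b
root-≤ t {y} {x} {b} root le = ℚP.*-cancelˡ-≤-pos t (+-cancelʳ-≤ x (subst (_≤ t * b + x) (sym root) le))

toℚᵘ-/ : ∀ i d → toℚᵘ (i / suc d) ≃ᵘ mkℚᵘ i d
toℚᵘ-/ i d = ℚP.toℚᵘ-fromℚᵘ (mkℚᵘ i d)

fraction-≤ : ∀ a b c d → a ℕ.* suc d ℕ.≤ c ℕ.* suc b → (+ a) / suc b ≤ (+ c) / suc d
fraction-≤ a b c d ad≤cb = ℚP.toℚᵘ-cancel-≤ (begin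
  toℚᵘ ((+ a) / suc b)  ≃⟨ toℚᵘ-/ (+ a) b ⟩
  mkℚᵘ (+ a) b          ≤⟨ *≤* (subst₂ ℤ._≤_ (ℤP.pos-* a (suc d)) (ℤP.pos-* c (suc b)) (ℤ.+≤+ ad≤cb)) ⟩
  mkℚᵘ (+ c) d          ≃⟨ ℚᵘP.≃-sym (toℚᵘ-/ (+ c) d) ⟩
  toℚᵘ ((+ c) / suc d)  ∎)
  where open ℚᵘP.≤-Reasoning

fraction-≡ : ∀ a b c d → a ℕ.* suc d ≡ c ℕ.* suc b → (+ a) / suc b ≡ (+ c) / suc d
fraction-≡ a b c d ad≡cb =
  ℚP.≤-antisym (fraction-≤ a b c d (ℕP.≤-reflexive ad≡cb))
               (fraction-≤ c d a b (ℕP.≤-reflexive (sym ad≡cb)))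

0≤fraction : ∀ a b → 0ℚ ≤ (+ a) / suc b
0≤fraction a b = fraction-≤ 0 0 a b z≤n

fraction-* : ∀ a b c d → (+ a) / suc b * ((+ c) / suc d) ≡ (+ (a ℕ.* c)) / (suc b ℕ.* suc d)
fraction-* a b c d = ℚP.toℚᵘ-injective (begin
  toℚᵘ ((+ a) / suc b * ((+ c) / suc d))          ≈⟨ ℚP.toℚᵘ-homo-* ((+ a) / suc b) ((+ c) / suc d) ⟩
  toℚᵘ ((+ a) / suc b) ℚᵘ.* toℚᵘ ((+ c) / suc d)  ≈⟨ ℚᵘP.*-cong (toℚᵘ-/ (+ a) b) (toℚᵘ-/ (+ c) d) ⟩
  mkℚᵘ (+ a ℤ.* + c) (d ℕ.+ b ℕ.* suc d)          ≡⟨ cong (λ i → mkℚᵘ i _) (sym (ℤP.pos-* a c)) ⟩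
  mkℚᵘ (+ (a ℕ.* c)) (d ℕ.+ b ℕ.* suc d)          ≈⟨ ℚᵘP.≃-sym (toℚᵘ-/ (+ (a ℕ.* c)) _) ⟩
  toℚᵘ ((+ (a ℕ.* c)) / (suc b ℕ.* suc d))        ∎)
  where open ℚᵘP.≃-Reasoning

fraction-+ : ∀ a b c d →
  (+ a) / suc b + (+ c) / suc d ≡ (+ (a ℕ.* suc d ℕ.+ c ℕ.* suc b)) / (suc b ℕ.* suc d)
fraction-+ a b c d = ℚP.toℚᵘ-injective (begin
  toℚᵘ ((+ a) / suc b + (+ c) / suc d)             ≈⟨ ℚP.toℚᵘ-homo-+ ((+ a) / suc b) ((+ c) / suc d) ⟩
  toℚᵘ ((+ a) / suc b) ℚᵘ.+ toℚᵘ ((+ c) / suc d)  ≈⟨ ℚᵘP.+-cong (toℚᵘ-/ (+ a) b) (toℚᵘ-/ (+ c) d) ⟩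
  mkℚᵘ (+ a ℤ.* + suc d ℤ.+ + c ℤ.* + suc b) _    ≡⟨ cong (λ i → mkℚᵘ i _) numerator ⟩
  mkℚᵘ (+ (a ℕ.* suc d ℕ.+ c ℕ.* suc b)) _         ≈⟨ ℚᵘP.≃-sym (toℚᵘ-/ _ _) ⟩
  toℚᵘ ((+ (a ℕ.* suc d ℕ.+ c ℕ.* suc b)) / (suc b ℕ.* suc d)) ∎)
  where
  open ℚᵘP.≃-Reasoning
  numerator : + a ℤ.* + suc d ℤ.+ + c ℤ.* + suc b ≡ + (a ℕ.* suc d ℕ.+ c ℕ.* suc b)
  numerator = trans (cong₂ ℤ._+_ (sym (ℤP.pos-* a (suc d))) (sym (ℤP.pos-* c (suc b))))
                    (sym (ℤP.pos-+ (a ℕ.* suc d) (c ℕ.* suc b)))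

scale-fraction : ∀ q a D .{{_ : ℕ.NonZero D}} → (+ q) / 1 * ((+ a) / D) ≡ (+ (q ℕ.* a)) / D
scale-fraction q a (suc d) = trans (fraction-* q 0 a d) (ℚP./-cong {+ (q ℕ.* a)} refl (ℕP.*-identityˡ (suc d)))

n/n≡1 : ∀ n .{{_ : ℕ.NonZero n}} → (+ n) / n ≡ 1ℚ
n/n≡1 (suc d) = fraction-≡ (suc d) d 1 0 (ℕP.*-comm (suc d) 1)

fraction≤1 : ∀ a n .{{_ : ℕ.NonZero n}} → a ℕ.≤ n → (+ a) / n ≤ 1ℚ
fraction≤1 a (suc b) a≤n =
  fraction-≤ a b 1 0 (subst₂ ℕ._≤_ (sym (ℕP.*-identityʳ a)) (sym (ℕP.*-identityˡ (suc b))) a≤n)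

fraction≡1 : ∀ a n .{{_ : ℕ.NonZero n}} → a ≡ n → (+ a) / n ≡ 1ℚ
fraction≡1 a n refl = n/n≡1 n

scaled-fraction-+ : ∀ q a b c d → (+ q) / 1 * ((+ a) / suc b) + (+ c) / suc d
                    ≡ (+ (q ℕ.* a ℕ.* suc d ℕ.+ c ℕ.* suc b)) / (suc b ℕ.* suc d)
scaled-fraction-+ q a b c d =
  trans (cong (_+ (+ c) / suc d) (scale-fraction q a (suc b))) (fraction-+ (q ℕ.* a) b c d)

neg1^-suc-suc : ∀ e → neg1^ (suc (suc e)) ≡ neg1^ e
neg1^-suc-suc e = cong (_/ 1) (begin
  -[1+ 0 ] ℤ.* (-[1+ 0 ] ℤ.* x)  ≡⟨ ℤP.-1*i≡-i _ ⟩
  ℤ.- (-[1+ 0 ] ℤ.* x)           ≡⟨ cong ℤ.-_ (ℤP.-1*i≡-i x) ⟩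
  ℤ.- ℤ.- x                      ≡⟨ ℤP.neg-involutive x ⟩
  x                              ∎)
  where
  open ≡-Reasoning
  x = -[1+ 0 ] ℤ.^ e

neg1^-suc : ∀ e → neg1^ (suc e) ≡ - neg1^ e
neg1^-suc zero    = refl
neg1^-suc (suc e) = begin
  neg1^ (suc (suc e))  ≡⟨ neg1^-suc-suc e ⟩
  neg1^ e              ≡⟨ sym (⁻¹-involutive (neg1^ e)) ⟩
  - - neg1^ e          ≡⟨ cong -_ (sym (neg1^-suc e)) ⟩
  - neg1^ (suc e)      ∎
  where open ≡-Reasoning

fact/-suc : ∀ m x → (+ suc m) / 1 * fact/ m x ≡ fact/ (suc m) x
fact/-suc m x = scale-fraction (suc m) (m !) (x !) {{x !≢0}}

fact/-self : ∀ m → fact/ m m ≡ 1ℚ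
fact/-self m = n/n≡1 (m !) {{m !≢0}}

sum1to-suc : ∀ n f → sum1to (suc n) f ≡ f 1 + sum1to n (f ∘ suc)
sum1to-suc n f = cong (λ xs → f 1 + foldr _+_ 0ℚ xs)
  (trans (map-applyUpTo (suc ∘ suc) f n) (sym (map-applyUpTo suc (f ∘ suc) n)))

sum1to-cancel : ∀ t (a b : ℕ → ℚ) → (∀ i → t * a (suc i) + b (suc i) ≡ 0ℚ) →
                ∀ n → t * sum1to n a + sum1to n b ≡ 0ℚ
sum1to-cancel t a b cancel zero    = trans (ℚP.+-identityʳ (t * 0ℚ)) (ℚP.*-zeroʳ t)
sum1to-cancel t a b cancel (suc n) = begin
  t * sum1to (suc n) a + sum1to (suc n) b
    ≡⟨ cong₂ (λ sa sb → t * sa + sb) (sum1to-suc n a) (sum1to-suc n b) ⟩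
  t * (a 1 + sum1to n (a ∘ suc)) + (b 1 + sum1to n (b ∘ suc))
    ≡⟨ regroup t (a 1) _ (b 1) _ ⟩
  (t * a 1 + b 1) + (t * sum1to n (a ∘ suc) + sum1to n (b ∘ suc))
    ≡⟨ cong₂ _+_ (cancel 0) (sum1to-cancel t (a ∘ suc) (b ∘ suc) (cancel ∘ suc) n) ⟩
  0ℚ + 0ℚ
    ≡⟨⟩
  0ℚ ∎
  where
  open ≡-Reasoning
  regroup : ∀ t a₁ sa b₁ sb → t * (a₁ + sa) + (b₁ + sb) ≡ (t * a₁ + b₁) + (t * sa + sb)
  regroup = solve-∀ ℚ-ring

summand : ℕ → ℕ → ℚ
summand m i = neg1^ (suc i) * fact/ m (m ℕ.+ i)

-- closed-h c m n is h r k for k = 2 + m and r = k + n, where c = inv-r+1/r-1 r.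
closed-h : ℚ → ℕ → ℕ → ℚ
closed-h c m n = neg1^ n * fact/ m (m ℕ.+ n) * c + sum1to n (summand m)

h-closed : ∀ {r} m n → 2 ℕ.+ m ℕ.+ n ≡ r → h r (2 ℕ.+ m) ≡ closed-h (inv-r+1/r-1 r) m n
h-closed m n refl with 2 ℕ.+ m ≤? 2 ℕ.+ m ℕ.+ n
... | yes _   = cong (λ e → neg1^ e * fact/ m (m ℕ.+ n) * inv-r+1/r-1 (2 ℕ.+ m ℕ.+ n) + sum1to e (summand m))
                     (ℕP.m+n∸m≡n m n)
... | no k≰r = ⊥-elim (k≰r (ℕP.m≤m+n (2 ℕ.+ m) n))

summand-cancel : ∀ m e j → (+ suc m) / 1 * (neg1^ (suc e) * fact/ m (m ℕ.+ suc j))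
                        + neg1^ e * fact/ (suc m) (suc m ℕ.+ j) ≡ 0ℚ
summand-cancel m e j = begin
  t * (neg1^ (suc e) * fact/ m (m ℕ.+ suc j)) + s * fact/ (suc m) (suc m ℕ.+ j)
    ≡⟨ cong₂ (λ s′ x → t * (s′ * fact/ m x) + s * fact/ (suc m) (suc m ℕ.+ j))
             (neg1^-suc e) (ℕP.+-suc m j) ⟩
  t * (- s * f) + s * fact/ (suc m) (suc m ℕ.+ j)
    ≡⟨ cong (λ g → t * (- s * f) + s * g) (sym (fact/-suc m (suc m ℕ.+ j))) ⟩
  t * (- s * f) + s * (t * f)
    ≡⟨ cancel t s f ⟩
  0ℚ ∎
  where
  open ≡-Reasoning
  t = (+ suc m) / 1
  s = neg1^ e
  f = fact/ m (suc m ℕ.+ j)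
  cancel : ∀ t s f → t * (- s * f) + s * (t * f) ≡ 0ℚ
  cancel = solve-∀ ℚ-ring

closed-h-recurrence : ∀ c m n → (+ suc m) / 1 * closed-h c m (suc n) + closed-h c (suc m) n ≡ 1ℚ
closed-h-recurrence c m n = begin
  t * closed-h c m (suc n) + closed-h c (suc m) n
    ≡⟨ cong (λ s → t * (A + s) + closed-h c (suc m) n) (sum1to-suc n (summand m)) ⟩
  t * (A + (summand m 1 + sum1to n (summand m ∘ suc))) + (C + sum1to n (summand (suc m)))
    ≡⟨ regroup t A (summand m 1) _ C _ ⟩
  (t * A + C) + (t * summand m 1 + (t * sum1to n (summand m ∘ suc) + sum1to n (summand (suc m))))
    ≡⟨ cong₂ _+_ leading (cong₂ _+_ first (sum1to-cancel t (summand m ∘ suc) (summand (suc m)) tails n)) ⟩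
  0ℚ + (1ℚ + 0ℚ)
    ≡⟨⟩
  1ℚ ∎
  where
  open ≡-Reasoning
  t = (+ suc m) / 1
  A = neg1^ (suc n) * fact/ m (m ℕ.+ suc n) * c
  C = neg1^ n * fact/ (suc m) (suc m ℕ.+ n) * c
  regroup : ∀ t A a₁ sa C sc → t * (A + (a₁ + sa)) + (C + sc) ≡ (t * A + C) + (t * a₁ + (t * sa + sc))
  regroup = solve-∀ ℚ-ring
  factor : ∀ t a b c → t * (a * c) + b * c ≡ (t * a + b) * c
  factor = solve-∀ ℚ-ring
  leading : t * A + C ≡ 0ℚ
  leading = begin
    t * A + C                                                          ≡⟨ factor t _ _ c ⟩
    (t * (neg1^ (suc n) * fact/ m (m ℕ.+ suc n)) + neg1^ n * fact/ (suc m) (suc m ℕ.+ n)) * c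
                                                                       ≡⟨ cong (_* c) (summand-cancel m n n) ⟩
    0ℚ * c                                                             ≡⟨ ℚP.*-zeroˡ c ⟩
    0ℚ                                                                 ∎
  first : t * summand m 1 ≡ 1ℚ
  first = begin
    t * (neg1^ 2 * fact/ m (m ℕ.+ 1))  ≡⟨ cong (λ x → t * x) (ℚP.*-identityˡ _) ⟩
    t * fact/ m (m ℕ.+ 1)              ≡⟨ cong (λ x → t * fact/ m x) (ℕP.+-comm m 1) ⟩
    t * fact/ m (suc m)                ≡⟨ fact/-suc m (suc m) ⟩
    fact/ (suc m) (suc m)              ≡⟨ fact/-self (suc m) ⟩
    1ℚ                                 ∎
  tails : ∀ i → t * summand m (suc (suc i)) + summand (suc m) (suc i) ≡ 0ℚ
  tails i = summand-cancel m (suc (suc i)) (suc i)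

coeff : ℕ → ℚ
coeff k = (+ (k ∸ 1)) / 1

h-recurrence : ∀ {r k} → 2 ℕ.≤ k → k ℕ.< r → coeff k * h r k + h r (suc k) ≡ 1ℚ
h-recurrence {r} {suc (suc m)} (s≤s (s≤s _)) k<r = begin
  t * h r (2 ℕ.+ m) + h r (3 ℕ.+ m)
    ≡⟨ cong₂ (λ y x → t * y + x) (h-closed m (suc n) (trans (cong (2 ℕ.+_) (ℕP.+-suc m n)) k+1+n≡r))
                                  (h-closed (suc m) n k+1+n≡r) ⟩
  t * closed-h c m (suc n) + closed-h c (suc m) n
    ≡⟨ closed-h-recurrence c m n ⟩
  1ℚ ∎
  where
  open ≡-Reasoning
  t = (+ suc m) / 1
  c = inv-r+1/r-1 r
  n = r ∸ (3 ℕ.+ m)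
  k+1+n≡r : 3 ℕ.+ m ℕ.+ n ≡ r
  k+1+n≡r = ℕP.m+[n∸m]≡n k<r

h-top : ∀ {k} → 2 ℕ.≤ k → h k k ≡ inv-r+1/r-1 k
h-top {suc (suc m)} (s≤s (s≤s _)) = begin
  h k k                                             ≡⟨ h-closed m 0 (ℕP.+-identityʳ k) ⟩
  1ℚ * fact/ m (m ℕ.+ 0) * c + 0ℚ                   ≡⟨ cong (λ n → 1ℚ * fact/ m n * c + 0ℚ) (ℕP.+-identityʳ m) ⟩
  1ℚ * fact/ m m * c + 0ℚ                           ≡⟨ cong (λ f → 1ℚ * f * c + 0ℚ) (fact/-self m) ⟩
  1ℚ * 1ℚ * c + 0ℚ                                  ≡⟨ unit c ⟩
  c                                                 ∎
  where
  open ≡-Reasoning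
  k = suc (suc m)
  c = inv-r+1/r-1 k
  unit : ∀ c → 1ℚ * 1ℚ * c + 0ℚ ≡ c
  unit = solve-∀ ℚ-ring

h-beyond : ∀ {r k} → r ℕ.< k → h r k ≡ 0ℚ
h-beyond {r} {k} r<k with k ≤? r
... | yes k≤r = ⊥-elim (ℕP.<⇒≱ r<k k≤r)
... | no _    = refl

upper : ℕ → ℚ
upper k = (+ k) / suc (k ℕ.* (k ∸ 1))

lower : ℕ → ℚ
lower k = (+ 1) / suc ((k ∸ 1) ℕ.* (k ∸ 2))

coeff-pos : ∀ {k} → 2 ℕ.≤ k → Positive (coeff k)
coeff-pos {suc (suc m)} (s≤s (s≤s _)) = ℚP.normalize-pos (suc m) 1

inv-r+1/r-1≡upper : ∀ k → inv-r+1/r-1 k ≡ upper k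
inv-r+1/r-1≡upper k = cong (λ n → (+ k) / suc n)
  (sym (trans (ℕP.*-distribˡ-∸ k k 1) (cong (k ℕ.* k ∸_) (ℕP.*-identityʳ k))))

upper≤1 : ∀ k → upper k ≤ 1ℚ
upper≤1 zero    = fraction≤1 0 1 z≤n
upper≤1 (suc j) = fraction≤1 (suc j) (suc (suc j ℕ.* j)) (s≤s (ℕP.m≤m+n j (j ℕ.* j)))

coeff*upper+lower-suc≡1 : ∀ {k} → 2 ℕ.≤ k → coeff k * upper k + lower (suc k) ≡ 1ℚ
coeff*upper+lower-suc≡1 {suc (suc m)} (s≤s (s≤s _)) =
  let d = (2 ℕ.+ m) ℕ.* (1 ℕ.+ m) in
  trans (scaled-fraction-+ (suc m) (2 ℕ.+ m) d 1 d)
    (fraction≡1 (suc m ℕ.* (2 ℕ.+ m) ℕ.* suc d ℕ.+ 1 ℕ.* suc d) (suc d ℕ.* suc d) (solve (m ∷ [])))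

coeff*upper≤1 : ∀ {k} → 2 ℕ.≤ k → coeff k * upper k ≤ 1ℚ
coeff*upper≤1 {k} 2≤k = begin
  coeff k * upper k                      ≡⟨ sym (ℚP.+-identityʳ _) ⟩
  coeff k * upper k + 0ℚ                 ≤⟨ ℚP.+-monoʳ-≤ (coeff k * upper k) (0≤fraction 1 (k ℕ.* (k ∸ 1))) ⟩
  coeff k * upper k + lower (suc k)      ≡⟨ coeff*upper+lower-suc≡1 2≤k ⟩
  1ℚ                                     ∎
  where open ℚP.≤-Reasoning

coeff*upper-suc+upper-suc≤1 : ∀ {k} → 2 ℕ.≤ k → coeff k * upper (suc k) + upper (suc k) ≤ 1ℚ
coeff*upper-suc+upper-suc≤1 {suc (suc m)} (s≤s (s≤s _)) =
  let d = (3 ℕ.+ m) ℕ.* (2 ℕ.+ m) in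
  subst (_≤ 1ℚ) (sym (scaled-fraction-+ (suc m) (3 ℕ.+ m) d (3 ℕ.+ m) d))
    (fraction≤1 (suc m ℕ.* (3 ℕ.+ m) ℕ.* suc d ℕ.+ (3 ℕ.+ m) ℕ.* suc d) (suc d ℕ.* suc d)
      (≤-by-difference (suc d) (solve (m ∷ []))))

coeff*lower+upper-suc≤1 : ∀ {k} → 3 ℕ.≤ k → coeff k * lower k + upper (suc k) ≤ 1ℚ
coeff*lower+upper-suc≤1 {suc (suc (suc p))} (s≤s (s≤s (s≤s _))) =
  let c = (2 ℕ.+ p) ℕ.* (1 ℕ.+ p)
      d = (4 ℕ.+ p) ℕ.* (3 ℕ.+ p) in
  subst (_≤ 1ℚ) (sym (scaled-fraction-+ (2 ℕ.+ p) 1 c (4 ℕ.+ p) d))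
    (fraction≤1 ((2 ℕ.+ p) ℕ.* 1 ℕ.* suc d ℕ.+ (4 ℕ.+ p) ℕ.* suc c) (suc c ℕ.* suc d)
      (≤-by-difference (p ℕ.* p ℕ.* p ℕ.* p ℕ.+ 8 ℕ.* (p ℕ.* p ℕ.* p) ℕ.+ 21 ℕ.* (p ℕ.* p) ℕ.+ 18 ℕ.* p ℕ.+ 1)
                       (solve (p ∷ []))))

lower≤upper : ∀ {k} → 3 ℕ.≤ k → lower k ≤ upper k
lower≤upper {suc (suc (suc p))} (s≤s (s≤s (s≤s _))) =
  fraction-≤ 1 ((2 ℕ.+ p) ℕ.* (1 ℕ.+ p)) (3 ℕ.+ p) ((3 ℕ.+ p) ℕ.* (2 ℕ.+ p))
    (≤-by-difference (p ℕ.* p ℕ.* p ℕ.+ 5 ℕ.* (p ℕ.* p) ℕ.+ 7 ℕ.* p ℕ.+ 2) (solve (p ∷ [])))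

module _ {k : ℕ} {x y : ℚ} (2≤k : 2 ℕ.≤ k) (recurrence : coeff k * y + x ≡ 1ℚ) where
  private instance
    coeff-positive : Positive (coeff k)
    coeff-positive = coeff-pos 2≤k

  recurrence-nonNeg : x ≤ upper (suc k) → 0ℚ ≤ y
  recurrence-nonNeg x≤u = ≤-root (coeff k) recurrence (begin
    coeff k * 0ℚ + x  ≡⟨ cong (_+ x) (ℚP.*-zeroʳ (coeff k)) ⟩
    0ℚ + x            ≡⟨ ℚP.+-identityˡ x ⟩
    x                 ≤⟨ x≤u ⟩
    upper (suc k)     ≤⟨ upper≤1 (suc k) ⟩
    1ℚ                ∎)
    where open ℚP.≤-Reasoning

  recurrence-≤-upper : lower (suc k) ≤ x → y ≤ upper k
  recurrence-≤-upper l≤x = root-≤ (coeff k) recurrence (begin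
    1ℚ                                  ≡⟨ sym (coeff*upper+lower-suc≡1 2≤k) ⟩
    coeff k * upper k + lower (suc k)   ≤⟨ ℚP.+-monoʳ-≤ (coeff k * upper k) l≤x ⟩
    coeff k * upper k + x               ∎)
    where open ℚP.≤-Reasoning

  recurrence-≥-lower : 3 ℕ.≤ k → x ≤ upper (suc k) → lower k ≤ y
  recurrence-≥-lower 3≤k x≤u = ≤-root (coeff k) recurrence (begin
    coeff k * lower k + x               ≤⟨ ℚP.+-monoʳ-≤ (coeff k * lower k) x≤u ⟩
    coeff k * lower k + upper (suc k)   ≤⟨ coeff*lower+upper-suc≤1 3≤k ⟩
    1ℚ                                  ∎)
    where open ℚP.≤-Reasoning

  recurrence-decreasing : x ≤ upper (suc k) → x ≤ y
  recurrence-decreasing x≤u = ≤-root (coeff k) recurrence (begin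
    coeff k * x + x                           ≤⟨ ℚP.+-mono-≤ (ℚP.*-monoˡ-≤-nonNeg (coeff k) x≤u) x≤u ⟩
    coeff k * upper (suc k) + upper (suc k)   ≤⟨ coeff*upper-suc+upper-suc≤1 2≤k ⟩
    1ℚ                                        ∎)
    where
    open ℚP.≤-Reasoning
    instance
      coeff-nonNeg : NonNegative (coeff k)
      coeff-nonNeg = ℚP.pos⇒nonNeg (coeff k)

InBounds : ℕ → ℕ → Set
InBounds r k = lower k ≤ h r k × h r k ≤ upper k

in-bounds : ∀ {r k} → 3 ℕ.≤ k → k ℕ.≤ r → InBounds r k
in-bounds {r} {k} 3≤k k≤r = subst (λ r → InBounds r k) (ℕP.m∸n+n≡m k≤r) (from-top (r ∸ k) 3≤k)
  where
  from-top : ∀ n {k} → 3 ℕ.≤ k → InBounds (n ℕ.+ k) k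
  from-top zero    {k} 3≤k =
    subst (λ y → lower k ≤ y × y ≤ upper k) (sym top) (lower≤upper 3≤k , ℚP.≤-refl)
    where top = trans (h-top (ℕP.<⇒≤ 3≤k)) (inv-r+1/r-1≡upper k)
  from-top (suc n) {k} 3≤k =
    recurrence-≥-lower 2≤k recurrence 3≤k x≤u , recurrence-≤-upper 2≤k recurrence l≤x
    where
    2≤k = ℕP.<⇒≤ 3≤k
    recurrence = h-recurrence 2≤k (s≤s (ℕP.m≤n+m k n))
    x-bounds : InBounds (suc n ℕ.+ k) (suc k)
    x-bounds = subst (λ r → InBounds r (suc k)) (ℕP.+-suc n k) (from-top n (ℕP.m≤n⇒m≤1+n 3≤k))
    l≤x = proj₁ x-bounds
    x≤u = proj₂ x-bounds

A1-A3 : ℕ → ℕ → Set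
A1-A3 r k = (h r (suc k) ≤ h r k)
          × ((0ℚ ≤ h r k) × (h r k ≤ inv-r+1/r-1 k))
          × (h r (suc k) ≤ 1ℚ - coeff k * h r k)

A1-A3-below-top : ∀ {r k} → 2 ℕ.≤ k → k ℕ.< r → A1-A3 r k
A1-A3-below-top {r} {k} 2≤k k<r =
  recurrence-decreasing 2≤k recurrence x≤u ,
  (recurrence-nonNeg 2≤k recurrence x≤u , subst (h r k ≤_) (sym (inv-r+1/r-1≡upper k)) y≤u) ,
  ℚP.≤-reflexive (p+q≡r⇒q≡r-p (coeff k * h r k) recurrence)
  where
  recurrence = h-recurrence 2≤k k<r
  x-bounds = in-bounds (s≤s 2≤k) k<r
  x≤u = proj₂ x-bounds
  y≤u = recurrence-≤-upper 2≤k recurrence (proj₁ x-bounds)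

A1-A3-at-top : ∀ {k} → 2 ℕ.≤ k → A1-A3 k k
A1-A3-at-top {k} 2≤k rewrite h-beyond (ℕP.n<1+n k) | h-top 2≤k =
  0≤u , (0≤u , ℚP.≤-refl) ,
  p≤q⇒0≤q-p (subst (λ u → coeff k * u ≤ 1ℚ) (sym (inv-r+1/r-1≡upper k)) (coeff*upper≤1 2≤k))
  where 0≤u = 0≤fraction k (k ℕ.* k ∸ k)

A1-A3-above-top : ∀ {r k} → r ℕ.< k → A1-A3 r k
A1-A3-above-top {r} {k} r<k rewrite h-beyond r<k | h-beyond (ℕP.m<n⇒m<1+n r<k) =
  ℚP.≤-refl , (ℚP.≤-refl , 0≤fraction k (k ℕ.* k ∸ k)) ,
  p≤q⇒0≤q-p (ℚP.≤-trans (ℚP.≤-reflexive (ℚP.*-zeroʳ (coeff k))) (0≤fraction 1 0))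

-- The hypothesis r ≥ 2 is not needed: in the case k = r it follows from k ≥ 2.
proposition19 : (r : ℕ) → 2 ℕ.≤ r → (k : ℕ) → 2 ℕ.≤ k →
    (h r (suc k) ≤ h r k)
    × ((0ℚ ≤ h r k) × (h r k ≤ (+ k) / suc (k ℕ.* k ∸ k)))
    × (h r (suc k) ≤ 1ℚ - ((+ (k ∸ 1)) / 1) * h r k)
proposition19 r _ k 2≤k with ℕP.<-cmp k r
... | tri< k<r _ _  = A1-A3-below-top 2≤k k<r
... | tri≈ _ refl _ = A1-A3-at-top 2≤k
... | tri> _ _ r<k  = A1-A3-above-top r<k
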